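{- Let $P_2$ be the path with two edges, let $p$ be a positive integer, and let $n=\lfloor\sqrt{p}\rfloor$. Then $$ w_{P_2}(p)=\begin{cases} \frac{2}{n}&\text{if }p\in[n^2,\,n^2+\lfloor n/2\rfloor],\\[.3em] \frac{2n+1}{p}&\text{if }p\in(n^2+\lfloor n/2\rfloor,\,n^2+2\lfloor n/2\rfloor],\\[.3em] \frac{2n+1}{n(n+1)}&\text{if }p\in(n^2+2\lfloor n/2\rfloor,\,n^2+n+\lfloor n/2\rfloor],\\[.3em] \frac{2n+2}{p}&\text{if }p\in(n^2+n+\lfloor n/2\rfloor,\,n^2+2n]. \end{cases} $$
   Context: A configuration of pebbles on a graph $G$ is a function $C:V(G)\to\mathbb{N}$; its size is $\sum_v C(v)$. A weight distribution $W$ on $G$ assigns to each edge $e$ a weight $w_e\in[0,1]$; $|W|=\sum_e w_e$, and $G_W$ is the weighted graph. A pebbling step along an edge $uv$ of weight $w$ removes $k$ pebbles from $u$ (positive integer $k$ not exceeding the number on $u$) and adds $\lfloor wk\rfloor$ pebbles to $v$. A target $t$ can be reached from $C$ if some sequence of pebbling steps yields at least one pebble on $t$. $G_W$ is $p$-solvable if every configuration of $p$ pebbles can reach every target vertex. $G$ is $(w,p)$-solvable if there is a weight distribution $W$ with $|W|=w$ such that $G_W$ is $p$-solvable. The pebbling weight function is $w_G(p)=\inf\{w : G \text{ is } (w,p)\text{ -solvable}\}$ (this infimum is attained).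
   Formalization: The edge weights $w_e$ and the totals $w$ over which $w_{P_2}(p)$ is minimised are rational rather than real. -}

module Defs where

open import Data.Nat as ℕ using (ℕ; zero; suc; _+_; _*_; _∸_; _≤ᵇ_; _/_)
open import Data.Integer as ℤ using (ℤ; +_)
open import Data.Rational as ℚ using (ℚ; 0ℚ; 1ℚ; floor)
open import Data.Fin using (Fin; zero; suc; _≟_)
open import Data.Bool using (Bool; true; false; if_then_else_)
open import Data.Product using (Σ; ∃; _×_; _,_)
open import Relation.Nullary using (does)
open import Relation.Binary.PropositionalEquality using (_≡_)

record Graph : Set where
  field
    nV        : ℕ
    nE        : ℕ
    endpoints : Fin nE → Fin nV × Fin nV
open Graph public

P₂ : Graph
P₂ = record { nV = 3 ; nE = 2 ; endpoints = ends }
  where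
  ends : Fin 2 → Fin 3 × Fin 3
  ends zero    = zero , suc zero
  ends (suc _) = suc zero , suc (suc zero)

Config : Graph → Set
Config G = Fin (nV G) → ℕ

sumFin : ∀ {k} → (Fin k → ℕ) → ℕ
sumFin {zero}  f = 0
sumFin {suc k} f = f zero + sumFin (λ i → f (suc i))

sumFinℚ : ∀ {k} → (Fin k → ℚ) → ℚ
sumFinℚ {zero}  f = 0ℚ
sumFinℚ {suc k} f = f zero ℚ.+ sumFinℚ (λ i → f (suc i))

size : (G : Graph) → Config G → ℕ
size G C = sumFin C

WeightFn : Graph → Set
WeightFn G = Fin (nE G) → ℚ

IsWeightDist : (G : Graph) → WeightFn G → Set
IsWeightDist G W = ∀ i → (0ℚ ℚ.≤ W i) × (W i ℚ.≤ 1ℚ)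

totalWeight : (G : Graph) → WeightFn G → ℚ
totalWeight G W = sumFinℚ W

-- ⌊ w k ⌋ as a natural number (w ≥ 0 in all uses)
floorMul : ℚ → ℕ → ℕ
floorMul w k = ℤ.∣ floor (w ℚ.* (+ k ℚ./ 1)) ∣

data Along (G : Graph) (i : Fin (nE G)) : Fin (nV G) → Fin (nV G) → Set where
  forward  : ∀ {u v} → endpoints G i ≡ (u , v) → Along G i u v
  backward : ∀ {u v} → endpoints G i ≡ (u , v) → Along G i v u

move : (G : Graph) → Config G → Fin (nV G) → Fin (nV G) → ℕ → ℚ → Config G
move G C u v k w x =
  (C x ∸ (if does (x ≟ u) then k else 0))
  + (if does (x ≟ v) then floorMul w k else 0)

data Reach (G : Graph) (W : WeightFn G) : Config G → Config G → Set where
  done : ∀ {C} → Reach G W C C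
  step : ∀ {C D} (i : Fin (nE G)) (u v : Fin (nV G)) → Along G i u v →
         (k : ℕ) → 1 ℕ.≤ k → k ℕ.≤ C u →
         Reach G W (move G C u v k (W i)) D → Reach G W C D

CanReach : (G : Graph) → WeightFn G → Config G → Fin (nV G) → Set
CanReach G W C t = ∃ λ D → Reach G W C D × (1 ℕ.≤ D t)

Solvable : (G : Graph) → WeightFn G → ℕ → Set
Solvable G W p = ∀ (C : Config G) → size G C ≡ p → ∀ t → CanReach G W C t

WPSolvable : (G : Graph) → ℚ → ℕ → Set
WPSolvable G w p = ∃ λ W → IsWeightDist G W × totalWeight G W ≡ w × Solvable G W p

-- w_G(p) = v, i.e. v is the least w such that G is (w,p)-solvable
-- (the infimum is attained).
PebblingWeightIs : (G : Graph) → ℕ → ℚ → Set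
PebblingWeightIs G p v = WPSolvable G v p × (∀ w → WPSolvable G w p → v ℚ.≤ w)

-- a / b as a rational (b = 0 never occurs in use)
_÷_ : ℕ → ℕ → ℚ
a ÷ zero  = 0ℚ
a ÷ suc b = + a ℚ./ suc b

P₂value : ℕ → ℕ → ℚ
P₂value p n =
  if p ≤ᵇ n * n + n / 2 then 2 ÷ n
  else if p ≤ᵇ n * n + 2 * (n / 2) then (2 * n + 1) ÷ p
  else if p ≤ᵇ n * n + n + n / 2 then (2 * n + 1) ÷ (n * (n + 1))
  else (2 * n + 2) ÷ p

-- Along an edge of weight w ≤ 1, moving k pebbles delivers f k = ⌊w k⌋, and f is monotone,
-- superadditive, f x ≤ x and f (x + j) ≤ f x + j. On P₂ with edge maps f = ⌊a ·⌋ and g = ⌊b ·⌋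
-- this makes z + g (y + f x) a non-increasing potential for a configuration (x, y, z), so
-- p-solvability forces ⌊b ⌊a p⌋⌋ ≥ 1 and ⌊a ⌊b p⌋⌋ ≥ 1; conversely these two conditions, together
-- with the middle vertex being reachable from every split x + y = p of the pebbles on the ends,
-- suffice. With A = ⌊a p⌋ and B = ⌊b p⌋ the necessary conditions give
-- a + b ≥ (A + B) / min(p, A B), and comparing A + B with 2n + 1 (AM–GM when A + B ≤ 2n) bounds
-- this below by the claimed value. It is attained by the weights (1/n, 1/n), (n/p, (n+1)/p),
-- (1/n, 1/(n+1)) and ((n+1)/p, (n+1)/p) on the four ranges of p.
module Submission where

open import Defs
open import Data.Nat as ℕ using (ℕ; zero; suc; _+_; _*_; _∸_; _≤_; _<_; s≤s; z≤n; _≤?_; _≤ᵇ_; _/_; _%_)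
import Data.Nat.Properties as ℕP
import Data.Nat.DivMod as ℕD
open import Data.Nat.Tactic.RingSolver using (solve)
open import Data.List using (_∷_; [])
open import Data.Integer as ℤ using (-[1+_])
import Data.Integer.Properties as ℤP
open import Data.Rational as ℚ using (ℚ; mkℚ; 0ℚ; 1ℚ; floor; toℚᵘ)
import Data.Rational.Properties as ℚP
open import Data.Rational.Unnormalised as ℚᵘ using (ℚᵘ; mkℚᵘ; *≡*; *≤*)
import Data.Rational.Unnormalised.Properties as ℚᵘP
open import Data.Product using (Σ; ∃; _×_; _,_)
open import Data.Sum as Sum using (_⊎_; inj₁; inj₂; [_,_])
open import Data.Fin using (Fin; zero; suc)
open import Data.Bool using (true; false; if_then_else_)
open import Function.Bundles using (_⇔_; mk⇔; Equivalence)
open import Relation.Nullary using (yes; no)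
open import Relation.Nullary.Reflects using (ofʸ; ofⁿ)
open import Relation.Binary.Definitions using (tri<; tri≈; tri>)
open import Relation.Binary.PropositionalEquality hiding ([_])

open Equivalence using (to; from)

-- frac a d stands for a / (1 + d).
frac : ℕ → ℕ → ℚᵘ
frac a d = mkℚᵘ (ℤ.+ a) d

frac-≤ : ∀ {a da b db} → a * suc db ≤ b * suc da → frac a da ℚᵘ.≤ frac b db
frac-≤ {a} {da} {b} {db} h =
  *≤* (subst₂ ℤ._≤_ (ℤP.pos-* a (suc db)) (ℤP.pos-* b (suc da)) (ℤ.+≤+ h))

frac-≤⁻¹ : ∀ {a da b db} → frac a da ℚᵘ.≤ frac b db → a * suc db ≤ b * suc da
frac-≤⁻¹ {a} {da} {b} {db} (*≤* h) =
  ℤP.drop‿+≤+ (subst₂ ℤ._≤_ (sym (ℤP.pos-* a (suc db))) (sym (ℤP.pos-* b (suc da))) h)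

frac-≃ : ∀ {a da b db} → a * suc db ≡ b * suc da → frac a da ℚᵘ.≃ frac b db
frac-≃ {a} {da} {b} {db} h =
  *≡* (trans (sym (ℤP.pos-* a (suc db))) (trans (cong ℤ.+_ h) (ℤP.pos-* b (suc da))))

frac-≃⁻¹ : ∀ {a da b db} → frac a da ℚᵘ.≃ frac b db → a * suc db ≡ b * suc da
frac-≃⁻¹ {a} {da} {b} {db} (*≡* h) =
  ℤP.+-injective (trans (ℤP.pos-* a (suc db)) (trans h (sym (ℤP.pos-* b (suc da)))))

frac-+ : ∀ a da b db → frac a da ℚᵘ.+ frac b db ℚᵘ.≃ frac (a * suc db + b * suc da) (db + da * suc db)
frac-+ a da b db = *≡* (cong (ℤ._* ℤ.+ suc (db + da * suc db))
  (trans (cong₂ ℤ._+_ (sym (ℤP.pos-* a (suc db))) (sym (ℤP.pos-* b (suc da))))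
         (sym (ℤP.pos-+ (a * suc db) (b * suc da)))))

frac-* : ∀ a da b db → frac a da ℚᵘ.* frac b db ℚᵘ.≃ frac (a * b) (db + da * suc db)
frac-* a da b db = *≡* (cong (ℤ._* ℤ.+ suc (db + da * suc db)) (sym (ℤP.pos-* a b)))

Represents : ℚ → ℕ → ℕ → Set
Represents w a d = toℚᵘ w ℚᵘ.≃ frac a d

÷-represents : ∀ a d → Represents (a ÷ suc d) a d
÷-represents a d = ℚP.toℚᵘ-fromℚᵘ (frac a d)

+-represents : ∀ {u v a da b db} → Represents u a da → Represents v b db →
  Represents (u ℚ.+ v) (a * suc db + b * suc da) (db + da * suc db)
+-represents {u} {v} {a} {da} {b} {db} u≈ v≈ =
  ℚᵘP.≃-trans (ℚP.toℚᵘ-homo-+ u v) (ℚᵘP.≃-trans (ℚᵘP.+-cong u≈ v≈) (frac-+ a da b db))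

*ℕ-represents : ∀ {w a d} → Represents w a d → ∀ k → Represents (w ℚ.* (ℤ.+ k ℚ./ 1)) (a * k) d
*ℕ-represents {w} {a} {d} w≈ k = ℚᵘP.≃-trans (ℚP.toℚᵘ-homo-* w (ℤ.+ k ℚ./ 1))
  (ℚᵘP.≃-trans (ℚᵘP.*-cong w≈ (ℚP.toℚᵘ-fromℚᵘ (frac k 0)))
  (ℚᵘP.≃-trans (frac-* a d k 0) (frac-≃ (cong (λ e → a * k * suc e) (sym (ℕP.*-identityʳ d))))))

÷-≤ : ∀ {w X E c d} → Represents w X E → c * suc E ≤ X * suc d → c ÷ suc d ℚ.≤ w
÷-≤ {c = c} {d} w≈ h = ℚP.toℚᵘ-cancel-≤
  (ℚᵘP.≤-respˡ-≃ (ℚᵘP.≃-sym (÷-represents c d)) (ℚᵘP.≤-respʳ-≃ (ℚᵘP.≃-sym w≈) (frac-≤ h)))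

÷-≡ : ∀ {w X E c d} → Represents w X E → X * suc d ≡ c * suc E → w ≡ c ÷ suc d
÷-≡ {c = c} {d} w≈ h = ℚP.toℚᵘ-injective
  (ℚᵘP.≃-trans w≈ (ℚᵘP.≃-trans (frac-≃ h) (ℚᵘP.≃-sym (÷-represents c d))))

UnitFraction : ℚ → Set
UnitFraction w = Σ ℕ λ a → Σ ℕ λ d → Represents w a d × a ≤ suc d

unitInterval-fraction : ∀ {w} → (0ℚ ℚ.≤ w) × (w ℚ.≤ 1ℚ) → UnitFraction w
unitInterval-fraction {mkℚ (ℤ.+ a) d _} (_ , w≤1) =
  a , d , ℚᵘP.≃-refl ,
  subst₂ _≤_ (ℕP.*-identityʳ a) (ℕP.*-identityˡ (suc d)) (frac-≤⁻¹ (ℚP.toℚᵘ-mono-≤ w≤1))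
unitInterval-fraction {mkℚ -[1+ _ ] _ _} (0≤w , _) with ℚP.toℚᵘ-mono-≤ 0≤w
... | *≤* ()

≤-/⇔ : ∀ m n o .{{_ : ℕ.NonZero o}} → m ≤ n / o ⇔ m * o ≤ n
≤-/⇔ m n o = mk⇔
  (λ h → ℕP.≤-trans (ℕP.*-monoˡ-≤ o h) (ℕD.m/n*n≤m n o))
  (λ h → subst (_≤ n / o) (ℕD.m*n/n≡m m o) (ℕD./-monoˡ-≤ o h))

*-cross-≤ : ∀ {m a b N X} .{{_ : ℕ.NonZero a}} → N * b ≡ X * a → m * a ≤ N → m * b ≤ X
*-cross-≤ {m} {a} {b} {N} {X} e h = ℕP.*-cancelʳ-≤ (m * b) X a (begin
  m * b * a ≡⟨ solve (m ∷ a ∷ b ∷ []) ⟩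
  m * a * b ≤⟨ ℕP.*-monoˡ-≤ b h ⟩
  N * b     ≡⟨ e ⟩
  X * a     ∎)
  where open ℕP.≤-Reasoning

≤∣floor∣⇔ : ∀ {q X E} m → Represents q X E → m ≤ ℤ.∣ floor q ∣ ⇔ m * suc E ≤ X
≤∣floor∣⇔ {mkℚ -[1+ _ ] D _} {X} _ (*≡* h) with trans h (sym (ℤP.pos-* X (suc D)))
... | ()
≤∣floor∣⇔ {mkℚ (ℤ.+ N) D coprime} {X} {E} m q≈ = mk⇔
  (λ h → *-cross-≤ {m} N≈X (to (≤-/⇔ m N (suc D)) (subst (m ≤_) ∣floor∣≡ h)))
  (λ h → subst (m ≤_) (sym ∣floor∣≡) (from (≤-/⇔ m N (suc D)) (*-cross-≤ {m} (sym N≈X) h)))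
  where
  ∣floor∣≡ : ℤ.∣ floor (mkℚ (ℤ.+ N) D coprime) ∣ ≡ N / suc D
  ∣floor∣≡ = cong ℤ.∣_∣ (ℤP.*-identityˡ (ℤ.+ (N / suc D)))
  N≈X : N * suc E ≡ X * suc D
  N≈X = frac-≃⁻¹ q≈

floorMul-zero : ∀ w → floorMul w 0 ≡ 0
floorMul-zero w = cong (λ q → ℤ.∣ floor q ∣) (ℚP.*-zeroʳ w)

record IsLossy (f : ℕ → ℕ) : Set where
  field
    mono          : ∀ {x y} → x ≤ y → f x ≤ f y
    superadditive : ∀ x y → f x + f y ≤ f (x + y)
    +-≤           : ∀ x j → f (x + j) ≤ f x + j
    ≤-id          : ∀ x → f x ≤ x

  +-≤-comm : ∀ x j → f (x + j) ≤ j + f x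
  +-≤-comm x j = ℕP.≤-trans (+-≤ x j) (ℕP.≤-reflexive (ℕP.+-comm (f x) j))

module FloorMul {w : ℚ} {a d : ℕ} (w≈ : Represents w a d) where
  open ℕP.≤-Reasoning

  ≤-floorMul⇔ : ∀ m k → m ≤ floorMul w k ⇔ m * suc d ≤ a * k
  ≤-floorMul⇔ m k = ≤∣floor∣⇔ m (*ℕ-represents w≈ k)

  1≤floorMul⇔ : ∀ k → 1 ≤ floorMul w k ⇔ suc d ≤ a * k
  1≤floorMul⇔ k = mk⇔
    (λ h → subst (_≤ a * k) (ℕP.*-identityˡ (suc d)) (to (≤-floorMul⇔ 1 k) h))
    (λ h → from (≤-floorMul⇔ 1 k) (subst (_≤ a * k) (sym (ℕP.*-identityˡ (suc d))) h))

  floorMul-≤ : ∀ k → floorMul w k * suc d ≤ a * k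
  floorMul-≤ k = to (≤-floorMul⇔ (floorMul w k) k) ℕP.≤-refl

  floorMul-mono : ∀ {x y} → x ≤ y → floorMul w x ≤ floorMul w y
  floorMul-mono {x} {y} x≤y =
    from (≤-floorMul⇔ _ y) (ℕP.≤-trans (floorMul-≤ x) (ℕP.*-monoʳ-≤ a x≤y))

  floorMul-superadditive : ∀ x y → floorMul w x + floorMul w y ≤ floorMul w (x + y)
  floorMul-superadditive x y = from (≤-floorMul⇔ _ (x + y)) (begin
    (floorMul w x + floorMul w y) * suc d         ≡⟨ ℕP.*-distribʳ-+ (suc d) (floorMul w x) _ ⟩
    floorMul w x * suc d + floorMul w y * suc d   ≤⟨ ℕP.+-mono-≤ (floorMul-≤ x) (floorMul-≤ y) ⟩
    a * x + a * y                                 ≡⟨ ℕP.*-distribˡ-+ a x y ⟨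
    a * (x + y)                                   ∎)

  module _ (a≤1+d : a ≤ suc d) where

    floorMul-≤-id : ∀ x → floorMul w x ≤ x
    floorMul-≤-id x = ℕP.*-cancelʳ-≤ (floorMul w x) x (suc d) (begin
      floorMul w x * suc d ≤⟨ floorMul-≤ x ⟩
      a * x                ≤⟨ ℕP.*-monoˡ-≤ x a≤1+d ⟩
      suc d * x            ≡⟨ ℕP.*-comm (suc d) x ⟩
      x * suc d            ∎)

    floorMul-+-≤ : ∀ x j → floorMul w (x + j) ≤ floorMul w x + j
    floorMul-+-≤ x j with ℕP.≤-total (floorMul w (x + j)) j
    ... | inj₁ m≤j = ℕP.≤-trans m≤j (ℕP.m≤n+m j (floorMul w x))
    ... | inj₂ j≤m = begin
        m               ≡⟨ ℕP.m∸n+n≡m j≤m ⟨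
        m ∸ j + j       ≤⟨ ℕP.+-monoˡ-≤ j (from (≤-floorMul⇔ (m ∸ j) x) [m∸j][1+d]≤ax) ⟩
        floorMul w x + j ∎
      where
      m = floorMul w (x + j)
      [m∸j][1+d]≤ax : (m ∸ j) * suc d ≤ a * x
      [m∸j][1+d]≤ax = ℕP.+-cancelʳ-≤ (j * suc d) _ _ (begin
        (m ∸ j) * suc d + j * suc d ≡⟨ ℕP.*-distribʳ-+ (suc d) (m ∸ j) j ⟨
        (m ∸ j + j) * suc d         ≡⟨ cong (_* suc d) (ℕP.m∸n+n≡m j≤m) ⟩
        m * suc d                   ≤⟨ floorMul-≤ (x + j) ⟩
        a * (x + j)                 ≡⟨ ℕP.*-distribˡ-+ a x j ⟩
        a * x + a * j               ≤⟨ ℕP.+-monoʳ-≤ (a * x) (ℕP.*-monoˡ-≤ j a≤1+d) ⟩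
        a * x + suc d * j           ≡⟨ cong (a * x +_) (ℕP.*-comm (suc d) j) ⟩
        a * x + j * suc d           ∎)

    floorMul-isLossy : IsLossy (floorMul w)
    floorMul-isLossy = record
      { mono          = floorMul-mono
      ; superadditive = floorMul-superadditive
      ; +-≤           = floorMul-+-≤
      ; ≤-id          = floorMul-≤-id
      }

weightDist-isLossy : ∀ {G W} → IsWeightDist G W → ∀ i → IsLossy (floorMul (W i))
weightDist-isLossy isDist i with unitInterval-fraction (isDist i)
... | _ , _ , w≈ , a≤1+d = FloorMul.floorMul-isLossy w≈ a≤1+d

collectable : (f g : ℕ → ℕ) → ℕ → ℕ → ℕ → ℕ
collectable f g x y z = z + g (y + f x)

-- The "+ 0" terms are the untouched coordinates of a configuration after a move,
-- in the normal form that move computes.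
module Collectable {f g : ℕ → ℕ} (F : IsLossy f) (G : IsLossy g) where
  open ℕP.≤-Reasoning
  private
    module F = IsLossy F
    module G = IsLossy G

  collectable-move₀₁ : ∀ x y z k → k ≤ x →
    collectable f g ((x ∸ k) + 0) (y + f k) (z + 0) ≤ collectable f g x y z
  collectable-move₀₁ x y z k k≤x = ℕP.+-mono-≤ (ℕP.≤-reflexive (ℕP.+-identityʳ z)) (G.mono (begin
    (y + f k) + f ((x ∸ k) + 0) ≡⟨ ℕP.+-assoc y (f k) _ ⟩
    y + (f k + f ((x ∸ k) + 0)) ≤⟨ ℕP.+-monoʳ-≤ y (F.superadditive k _) ⟩
    y + f (k + ((x ∸ k) + 0))   ≡⟨ cong (λ t → y + f (k + t)) (ℕP.+-identityʳ (x ∸ k)) ⟩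
    y + f (k + (x ∸ k))         ≡⟨ cong (λ t → y + f t) (ℕP.m+[n∸m]≡n k≤x) ⟩
    y + f x                     ∎))

  collectable-move₁₀ : ∀ x y z k → k ≤ y →
    collectable f g (x + f k) ((y ∸ k) + 0) (z + 0) ≤ collectable f g x y z
  collectable-move₁₀ x y z k k≤y = ℕP.+-mono-≤ (ℕP.≤-reflexive (ℕP.+-identityʳ z)) (G.mono (begin
    ((y ∸ k) + 0) + f (x + f k) ≡⟨ cong (_+ f (x + f k)) (ℕP.+-identityʳ (y ∸ k)) ⟩
    (y ∸ k) + f (x + f k)       ≤⟨ ℕP.+-monoʳ-≤ (y ∸ k) (F.+-≤-comm x (f k)) ⟩
    (y ∸ k) + (f k + f x)       ≤⟨ ℕP.+-monoʳ-≤ (y ∸ k) (ℕP.+-monoˡ-≤ (f x) (F.≤-id k)) ⟩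
    (y ∸ k) + (k + f x)         ≡⟨ ℕP.+-assoc (y ∸ k) k (f x) ⟨
    (y ∸ k) + k + f x           ≡⟨ cong (_+ f x) (ℕP.m∸n+n≡m k≤y) ⟩
    y + f x                     ∎))

  collectable-move₁₂ : ∀ x y z k → k ≤ y →
    collectable f g (x + 0) ((y ∸ k) + 0) (z + g k) ≤ collectable f g x y z
  collectable-move₁₂ x y z k k≤y = begin
    (z + g k) + g (((y ∸ k) + 0) + f (x + 0)) ≡⟨ ℕP.+-assoc z (g k) _ ⟩
    z + (g k + g (((y ∸ k) + 0) + f (x + 0))) ≤⟨ ℕP.+-monoʳ-≤ z (G.superadditive k _) ⟩
    z + g (k + (((y ∸ k) + 0) + f (x + 0)))   ≡⟨ cong (λ t → z + g t) k+[y∸k+fx]≡y+fx ⟩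
    z + g (y + f x)                           ∎
    where
    k+[y∸k+fx]≡y+fx : k + (((y ∸ k) + 0) + f (x + 0)) ≡ y + f x
    k+[y∸k+fx]≡y+fx = begin-equality
      k + (((y ∸ k) + 0) + f (x + 0)) ≡⟨ cong₂ (λ s t → k + (s + f t)) (ℕP.+-identityʳ _) (ℕP.+-identityʳ x) ⟩
      k + ((y ∸ k) + f x)             ≡⟨ ℕP.+-assoc k (y ∸ k) (f x) ⟨
      k + (y ∸ k) + f x               ≡⟨ cong (_+ f x) (ℕP.m+[n∸m]≡n k≤y) ⟩
      y + f x                         ∎

  collectable-move₂₁ : ∀ x y z k → k ≤ z →
    collectable f g (x + 0) (y + g k) ((z ∸ k) + 0) ≤ collectable f g x y z
  collectable-move₂₁ x y z k k≤z = begin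
    ((z ∸ k) + 0) + g ((y + g k) + f (x + 0)) ≡⟨ cong₂ (λ s t → s + g ((y + g k) + f t)) (ℕP.+-identityʳ _) (ℕP.+-identityʳ x) ⟩
    (z ∸ k) + g ((y + g k) + f x)             ≡⟨ cong (λ t → (z ∸ k) + g t) (ℕP.+-comm (y + g k) (f x)) ⟩
    (z ∸ k) + g (f x + (y + g k))             ≡⟨ cong (λ t → (z ∸ k) + g t) (ℕP.+-assoc (f x) y (g k)) ⟨
    (z ∸ k) + g ((f x + y) + g k)             ≤⟨ ℕP.+-monoʳ-≤ (z ∸ k) (G.+-≤-comm (f x + y) (g k)) ⟩
    (z ∸ k) + (g k + g (f x + y))             ≤⟨ ℕP.+-monoʳ-≤ (z ∸ k) (ℕP.+-monoˡ-≤ _ (G.≤-id k)) ⟩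
    (z ∸ k) + (k + g (f x + y))               ≡⟨ ℕP.+-assoc (z ∸ k) k _ ⟨
    (z ∸ k) + k + g (f x + y)                 ≡⟨ cong₂ (λ s t → s + g t) (ℕP.m∸n+n≡m k≤z) (ℕP.+-comm (f x) y) ⟩
    z + g (y + f x)                           ∎

  collectable-≥ : ∀ x y {p} → x + y ≡ p → g (f p) ≤ g (y + f x)
  collectable-≥ x y refl = G.mono (F.+-≤-comm x y)

Reach-trans : ∀ {G W C D E} → Reach G W C D → Reach G W D E → Reach G W C E
Reach-trans done D⇝E = D⇝E
Reach-trans (step i u v along k 1≤k k≤Cu C′⇝D) D⇝E = step i u v along k 1≤k k≤Cu (Reach-trans C′⇝D D⇝E)

Reach-antitone : ∀ {G W} (Φ : Config G → ℕ) →
  (∀ C i u v → Along G i u v → ∀ k → k ≤ C u → Φ (move G C u v k (W i)) ≤ Φ C) →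
  ∀ {C D} → Reach G W C D → Φ D ≤ Φ C
Reach-antitone Φ Φ-step done = ℕP.≤-refl
Reach-antitone Φ Φ-step {C} (step i u v along k _ k≤Cu C′⇝D) =
  ℕP.≤-trans (Reach-antitone Φ Φ-step C′⇝D) (Φ-step C i u v along k k≤Cu)

CanReach-occupied : ∀ {G W} C t → (C t ≡ 0 → CanReach G W C t) → CanReach G W C t
CanReach-occupied C t reach with C t in Ct≡
... | zero  = reach refl
... | suc _ = C , done , ℕP.≤-trans (s≤s z≤n) (ℕP.≤-reflexive (sym Ct≡))

v₀ v₁ v₂ : Fin 3
v₀ = zero
v₁ = suc zero
v₂ = suc (suc zero)

move-target : ∀ {i u v} → Along P₂ i u v → ∀ C k w → move P₂ C u v k w v ≡ C v + floorMul w k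
move-target {zero}     (forward refl)  C k w = refl
move-target {zero}     (backward refl) C k w = refl
move-target {suc zero} (forward refl)  C k w = refl
move-target {suc zero} (backward refl) C k w = refl

moveAll : ∀ W (C : Config P₂) {i u v} → Along P₂ i u v →
  ∃ λ D → Reach P₂ W C D × C v + floorMul (W i) (C u) ≤ D v
moveAll W C {i} {u} {v} along with C u in Cu≡
... | zero  = C , done , ℕP.≤-reflexive (trans (cong (C v +_) (floorMul-zero (W i))) (ℕP.+-identityʳ (C v)))
... | suc j = move P₂ C u v (suc j) (W i)
            , step i u v along (suc j) (s≤s z≤n) (ℕP.≤-reflexive (sym Cu≡)) done
            , ℕP.≤-reflexive (sym (move-target along C (suc j) (W i)))

moveAll-twice : ∀ W (C : Config P₂) {i j a m b} → IsLossy (floorMul (W j)) →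
  Along P₂ i a m → Along P₂ j m b →
  ∃ λ E → Reach P₂ W C E × floorMul (W j) (C m + floorMul (W i) (C a)) ≤ E b
moveAll-twice W C Fj a→m m→b =
  let D , C⇝D , Dm≥ = moveAll W C a→m
      E , D⇝E , Eb≥ = moveAll W D m→b
  in E , Reach-trans C⇝D D⇝E , ℕP.≤-trans (IsLossy.mono Fj Dm≥) (ℕP.≤-trans (ℕP.m≤n+m _ _) Eb≥)

module P₂Pebbling (W : WeightFn P₂) (lossy : ∀ i → IsLossy (floorMul (W i))) where
  fa fb : ℕ → ℕ
  fa = floorMul (W zero)
  fb = floorMul (W (suc zero))

  private
    module C₀₂ = Collectable (lossy zero) (lossy (suc zero))
    module C₂₀ = Collectable (lossy (suc zero)) (lossy zero)

  collectable₂ collectable₀ : Config P₂ → ℕ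
  collectable₂ C = collectable fa fb (C v₀) (C v₁) (C v₂)
  collectable₀ C = collectable fb fa (C v₂) (C v₁) (C v₀)

  collectable₂-step : ∀ C i u v → Along P₂ i u v → ∀ k → k ≤ C u →
    collectable₂ (move P₂ C u v k (W i)) ≤ collectable₂ C
  collectable₂-step C zero       _ _ (forward refl)  = C₀₂.collectable-move₀₁ (C v₀) (C v₁) (C v₂)
  collectable₂-step C zero       _ _ (backward refl) = C₀₂.collectable-move₁₀ (C v₀) (C v₁) (C v₂)
  collectable₂-step C (suc zero) _ _ (forward refl)  = C₀₂.collectable-move₁₂ (C v₀) (C v₁) (C v₂)
  collectable₂-step C (suc zero) _ _ (backward refl) = C₀₂.collectable-move₂₁ (C v₀) (C v₁) (C v₂)

  collectable₀-step : ∀ C i u v → Along P₂ i u v → ∀ k → k ≤ C u →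
    collectable₀ (move P₂ C u v k (W i)) ≤ collectable₀ C
  collectable₀-step C zero       _ _ (forward refl)  = C₂₀.collectable-move₂₁ (C v₂) (C v₁) (C v₀)
  collectable₀-step C zero       _ _ (backward refl) = C₂₀.collectable-move₁₂ (C v₂) (C v₁) (C v₀)
  collectable₀-step C (suc zero) _ _ (forward refl)  = C₂₀.collectable-move₁₀ (C v₂) (C v₁) (C v₀)
  collectable₀-step C (suc zero) _ _ (backward refl) = C₂₀.collectable-move₀₁ (C v₂) (C v₁) (C v₀)

  solvable⇒1≤fb[fa] : ∀ p → Solvable P₂ W p → 1 ≤ fb (fa p)
  solvable⇒1≤fb[fa] p solvable =
    let D , C⇝D , 1≤Dv₂ = solvable onV₀ (ℕP.+-identityʳ p) v₂
    in ℕP.≤-trans 1≤Dv₂ (ℕP.≤-trans (ℕP.m≤m+n (D v₂) _) (Reach-antitone collectable₂ collectable₂-step C⇝D))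
    where
    onV₀ : Config P₂
    onV₀ zero    = p
    onV₀ (suc _) = 0

  solvable⇒1≤fa[fb] : ∀ p → Solvable P₂ W p → 1 ≤ fa (fb p)
  solvable⇒1≤fa[fb] p solvable =
    let D , C⇝D , 1≤Dv₀ = solvable onV₂ (ℕP.+-identityʳ p) v₀
    in ℕP.≤-trans 1≤Dv₀ (ℕP.≤-trans (ℕP.m≤m+n (D v₀) _) (Reach-antitone collectable₀ collectable₀-step C⇝D))
    where
    onV₂ : Config P₂
    onV₂ (suc (suc zero)) = p
    onV₂ _                = 0

  solvable-criterion : ∀ p → 1 ≤ fb (fa p) → 1 ≤ fa (fb p) →
    (∀ x y → x + y ≡ p → 1 ≤ fa x ⊎ 1 ≤ fb y) → Solvable P₂ W p
  solvable-criterion p 1≤fb[fa] 1≤fa[fb] split C size≡p t = CanReach-occupied C t (reach t)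
    where
    size≡ : C v₀ + (C v₁ + C v₂) ≡ p
    size≡ = trans (cong (λ s → C v₀ + (C v₁ + s)) (sym (ℕP.+-identityʳ (C v₂)))) size≡p

    fillFrom₀ : 1 ≤ fa (C v₀) → CanReach P₂ W C v₁
    fillFrom₀ 1≤fa = let D , C⇝D , D₁≥ = moveAll W C {zero} (forward refl)
                     in D , C⇝D , ℕP.≤-trans 1≤fa (ℕP.≤-trans (ℕP.m≤n+m _ (C v₁)) D₁≥)

    fillFrom₂ : 1 ≤ fb (C v₂) → CanReach P₂ W C v₁
    fillFrom₂ 1≤fb = let D , C⇝D , D₁≥ = moveAll W C {suc zero} (backward refl)
                     in D , C⇝D , ℕP.≤-trans 1≤fb (ℕP.≤-trans (ℕP.m≤n+m _ (C v₁)) D₁≥)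

    reach : ∀ t → C t ≡ 0 → CanReach P₂ W C t
    reach zero C₀≡0 =
      let E , C⇝E , E₀≥ = moveAll-twice W C (lossy zero) (backward refl) (backward refl)
      in E , C⇝E , ℕP.≤-trans 1≤fa[fb] (ℕP.≤-trans (C₂₀.collectable-≥ (C v₂) (C v₁) p₂₁) E₀≥)
      where
      p₂₁ : C v₂ + C v₁ ≡ p
      p₂₁ = trans (ℕP.+-comm (C v₂) (C v₁)) (subst (λ s → s + (C v₁ + C v₂) ≡ p) C₀≡0 size≡)
    reach (suc zero) C₁≡0 = [ fillFrom₀ , fillFrom₂ ] (split (C v₀) (C v₂) p₀₂)
      where
      p₀₂ : C v₀ + C v₂ ≡ p
      p₀₂ = subst (λ s → C v₀ + (s + C v₂) ≡ p) C₁≡0 size≡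
    reach (suc (suc zero)) C₂≡0 =
      let E , C⇝E , E₂≥ = moveAll-twice W C (lossy (suc zero)) (forward refl) (forward refl)
      in E , C⇝E , ℕP.≤-trans 1≤fb[fa] (ℕP.≤-trans (C₀₂.collectable-≥ (C v₀) (C v₁) p₀₁) E₂≥)
      where
      p₀₁ : C v₀ + C v₁ ≡ p
      p₀₁ = trans (cong (C v₀ +_) (sym (ℕP.+-identityʳ (C v₁))))
                  (subst (λ s → C v₀ + (C v₁ + s) ≡ p) C₂≡0 size≡)

totalWeight-represents : ∀ {W : WeightFn P₂} {a da b db} →
  Represents (W zero) a da → Represents (W (suc zero)) b db →
  Represents (totalWeight P₂ W) (a * suc db + b * suc da) (db + da * suc db)
totalWeight-represents {W} Wa≈ Wb≈ = subst (λ v → Represents (W zero ℚ.+ v) _ _)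
  (sym (ℚP.+-identityʳ (W (suc zero)))) (+-represents Wa≈ Wb≈)

÷-unitInterval : ∀ {a d} → a ≤ suc d → (0ℚ ℚ.≤ a ÷ suc d) × (a ÷ suc d ℚ.≤ 1ℚ)
÷-unitInterval {a} {d} a≤1+d =
  ℚP.toℚᵘ-cancel-≤ (ℚᵘP.≤-respʳ-≃ (ℚᵘP.≃-sym (÷-represents a d)) (frac-≤ z≤n)) ,
  ℚP.toℚᵘ-cancel-≤ (ℚᵘP.≤-respˡ-≃ (ℚᵘP.≃-sym (÷-represents a d))
    (frac-≤ (subst₂ _≤_ (sym (ℕP.*-identityʳ a)) (sym (ℕP.*-identityˡ (suc d))) a≤1+d)))

-- X / Y stands for the total weight a + b, and A, B for ⌊a p⌋, ⌊b p⌋.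
WeightLowerBound : ℕ → ℕ → ℕ → Set
WeightLowerBound p c d = ∀ {A B} → 1 ≤ A → 1 ≤ B → ∀ {X Y} →
  (A + B) * Y ≤ p * X → (A + B) * Y ≤ A * B * X → c * Y ≤ d * X

[A+B]/p≤a+b : ∀ A B α β {p sδ sε} → A * sδ ≤ α * p → B * sε ≤ β * p →
  (A + B) * (sδ * sε) ≤ p * (α * sε + β * sδ)
[A+B]/p≤a+b A B α β {p} {sδ} {sε} A≤ap B≤bp = begin
  (A + B) * (sδ * sε)       ≡⟨ solve (A ∷ B ∷ sδ ∷ sε ∷ []) ⟩
  A * sδ * sε + B * sε * sδ ≤⟨ ℕP.+-mono-≤ (ℕP.*-monoˡ-≤ sε A≤ap) (ℕP.*-monoˡ-≤ sδ B≤bp) ⟩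
  α * p * sε + β * p * sδ   ≡⟨ solve (α ∷ β ∷ p ∷ sδ ∷ sε ∷ []) ⟩
  p * (α * sε + β * sδ)     ∎
  where open ℕP.≤-Reasoning

[A+B]/AB≤a+b : ∀ A B α β {sδ sε} → sε ≤ β * A → sδ ≤ α * B →
  (A + B) * (sδ * sε) ≤ A * B * (α * sε + β * sδ)
[A+B]/AB≤a+b A B α β {sδ} {sε} 1≤bA 1≤aB = begin
  (A + B) * (sδ * sε)                 ≡⟨ solve (A ∷ B ∷ sδ ∷ sε ∷ []) ⟩
  A * sε * sδ + B * sδ * sε           ≤⟨ ℕP.+-mono-≤ (ℕP.*-monoʳ-≤ (A * sε) 1≤aB) (ℕP.*-monoʳ-≤ (B * sδ) 1≤bA) ⟩
  A * sε * (α * B) + B * sδ * (β * A) ≡⟨ solve (A ∷ B ∷ α ∷ β ∷ sδ ∷ sε ∷ []) ⟩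
  A * B * (α * sε + β * sδ)           ∎
  where open ℕP.≤-Reasoning

weight-≥ : ∀ {p c D} .{{_ : ℕ.NonZero D}} → WeightLowerBound p c D → ∀ w → WPSolvable P₂ w p → c ÷ D ℚ.≤ w
weight-≥ {p} {c} {suc d} lb _ (W , isDist , refl , solvable) =
  bound (unitInterval-fraction (isDist zero)) (unitInterval-fraction (isDist (suc zero)))
  where
  lossy : ∀ i → IsLossy (floorMul (W i))
  lossy = weightDist-isLossy {P₂} isDist
  open P₂Pebbling W lossy

  bound : UnitFraction (W zero) → UnitFraction (W (suc zero)) → c ÷ suc d ℚ.≤ totalWeight P₂ W
  bound (α , δ , Wa≈ , _) (β , ε , Wb≈ , _) = ÷-≤ {c = c} {d} (totalWeight-represents {W} Wa≈ Wb≈)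
    (subst (c * (suc δ * suc ε) ≤_) (ℕP.*-comm (suc d) _)
      (lb 1≤A 1≤B
        ([A+B]/p≤a+b (fa p) (fb p) α β (A.floorMul-≤ p) (B.floorMul-≤ p))
        ([A+B]/AB≤a+b (fa p) (fb p) α β (to (B.1≤floorMul⇔ (fa p)) 1≤fb[fa])
                                         (to (A.1≤floorMul⇔ (fb p)) 1≤fa[fb]))))
    where
    module A = FloorMul Wa≈
    module B = FloorMul Wb≈
    1≤fb[fa] : 1 ≤ fb (fa p)
    1≤fb[fa] = solvable⇒1≤fb[fa] p solvable
    1≤fa[fb] : 1 ≤ fa (fb p)
    1≤fa[fb] = solvable⇒1≤fa[fb] p solvable
    1≤A : 1 ≤ fa p
    1≤A = ℕP.≤-trans 1≤fb[fa] (IsLossy.≤-id (lossy (suc zero)) (fa p))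
    1≤B : 1 ≤ fb p
    1≤B = ℕP.≤-trans 1≤fa[fb] (IsLossy.≤-id (lossy zero) (fb p))

weight-≤ : ∀ {p c D} .{{_ : ℕ.NonZero D}} a Da b Db .{{_ : ℕ.NonZero Da}} .{{_ : ℕ.NonZero Db}} →
  a ≤ Da → b ≤ Db →
  (a * Db + b * Da) * D ≡ c * (Da * Db) →
  (∃ λ m → m * Da ≤ a * p × Db ≤ b * m) →
  (∃ λ m → m * Db ≤ b * p × Da ≤ a * m) →
  (∀ x y → x + y ≡ p → Da ≤ a * x ⊎ Db ≤ b * y) →
  WPSolvable P₂ (c ÷ D) p
weight-≤ {p} {c} {suc d} a (suc da) b (suc db) a≤ b≤ total (m , m≤ap , 1≤bm) (m′ , m′≤bp , 1≤am′) split =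
  W , isDist , ÷-≡ {c = c} {d} (totalWeight-represents {W} (÷-represents a da) (÷-represents b db)) total ,
  solvable-criterion p
    (ℕP.≤-trans (from (B.1≤floorMul⇔ m) 1≤bm) (B.floorMul-mono (from (A.≤-floorMul⇔ m p) m≤ap)))
    (ℕP.≤-trans (from (A.1≤floorMul⇔ m′) 1≤am′) (A.floorMul-mono (from (B.≤-floorMul⇔ m′ p) m′≤bp)))
    (λ x y x+y≡p → Sum.map (from (A.1≤floorMul⇔ x)) (from (B.1≤floorMul⇔ y)) (split x y x+y≡p))
  where
  W : WeightFn P₂
  W zero    = a ÷ suc da
  W (suc _) = b ÷ suc db
  isDist : IsWeightDist P₂ W
  isDist zero    = ÷-unitInterval a≤
  isDist (suc _) = ÷-unitInterval b≤
  module A = FloorMul (÷-represents a da)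
  module B = FloorMul (÷-represents b db)
  open P₂Pebbling W (weightDist-isLossy {P₂} isDist)

cross-≤-trans : ∀ {x X Y} u c d → 1 ≤ x → u * Y ≤ x * X → c * x ≤ d * u → c * Y ≤ d * X
cross-≤-trans {x} {X} {Y} u c d 1≤x uY≤xX cx≤du = ℕP.*-cancelˡ-≤ x {{ℕ.>-nonZero 1≤x}} (begin
  x * (c * Y) ≡⟨ solve (x ∷ c ∷ Y ∷ []) ⟩
  c * x * Y   ≤⟨ ℕP.*-monoˡ-≤ Y cx≤du ⟩
  d * u * Y   ≡⟨ ℕP.*-assoc d u Y ⟩
  d * (u * Y) ≤⟨ ℕP.*-monoʳ-≤ d uY≤xX ⟩
  d * (x * X) ≡⟨ solve (d ∷ x ∷ X ∷ []) ⟩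
  x * (d * X) ∎)
  where open ℕP.≤-Reasoning

4AB≤[A+B]²-≤ : ∀ {A B} → A ≤ B → 4 * (A * B) ≤ (A + B) * (A + B)
4AB≤[A+B]²-≤ {A} A≤B with ℕP.m≤n⇒∃[o]m+o≡n A≤B
... | t , refl = ℕP.≤-trans (ℕP.m≤m+n _ (t * t)) (ℕP.≤-reflexive (solve (A ∷ t ∷ [])))

4AB≤[A+B]² : ∀ A B → 4 * (A * B) ≤ (A + B) * (A + B)
4AB≤[A+B]² A B with ℕP.≤-total A B
... | inj₁ A≤B = 4AB≤[A+B]²-≤ A≤B
... | inj₂ B≤A = subst₂ (λ s t → 4 * s ≤ t) (ℕP.*-comm B A) (cong (λ s → s * s) (ℕP.+-comm B A))
                   (4AB≤[A+B]²-≤ B≤A)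

2AB≤n[A+B] : ∀ {A B n} → A + B ≤ 2 * n → 2 * (A * B) ≤ n * (A + B)
2AB≤n[A+B] {A} {B} {n} A+B≤2n = ℕP.*-cancelˡ-≤ 2 (begin
  2 * (2 * (A * B)) ≡⟨ solve (A ∷ B ∷ []) ⟩
  4 * (A * B)       ≤⟨ 4AB≤[A+B]² A B ⟩
  (A + B) * (A + B) ≤⟨ ℕP.*-monoˡ-≤ (A + B) A+B≤2n ⟩
  2 * n * (A + B)   ≡⟨ ℕP.*-assoc 2 n (A + B) ⟩
  2 * (n * (A + B)) ∎)
  where open ℕP.≤-Reasoning

AB≤n[n+1] : ∀ {A B n} → A + B ≡ 2 * n + 1 → A * B ≤ n * (n + 1)
AB≤n[n+1] {A} {B} {n} A+B≡2n+1 = ℕP.m<1+n⇒m≤n (ℕP.*-cancelˡ-< 4 (A * B) (suc (n * (n + 1))) (begin-strict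
  4 * (A * B)               ≤⟨ 4AB≤[A+B]² A B ⟩
  (A + B) * (A + B)         ≡⟨ cong (λ t → t * t) A+B≡2n+1 ⟩
  (2 * n + 1) * (2 * n + 1) ≡⟨ solve (n ∷ []) ⟩
  4 * (n * (n + 1)) + 1     <⟨ ℕP.+-monoʳ-< (4 * (n * (n + 1))) (s≤s (s≤s z≤n)) ⟩
  4 * (n * (n + 1)) + 4     ≡⟨ solve (n ∷ []) ⟩
  4 * suc (n * (n + 1))     ∎))
  where open ℕP.≤-Reasoning

-- Compare A + B with 2n + 1: above it (A + B)/p ≥ (2n + 2)/p, below it AM–GM gives
-- (A + B)/(A B) ≥ 2/n, and at equality A B ≤ n (n + 1).
weightLowerBound : ∀ {p n c d} → 1 ≤ p →
  c * p ≤ d * (2 * n + 2) → c * n ≤ 2 * d →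
  (∀ m → m ≤ n * (n + 1) → c * p ≤ d * (2 * n + 1) ⊎ c * m ≤ d * (2 * n + 1)) →
  WeightLowerBound p c d
weightLowerBound {p} {n} {c} {d} 1≤p large small balanced {A} {B} 1≤A 1≤B {X} {Y} viaP viaAB
  with ℕP.<-cmp (A + B) (2 * n + 1)
... | tri> _ _ A+B>2n+1 = cross-≤-trans (A + B) c d 1≤p viaP (ℕP.≤-trans large (ℕP.*-monoʳ-≤ d
        (subst (_≤ A + B) (sym (ℕP.+-suc (2 * n) 1)) A+B>2n+1)))
... | tri≈ _ A+B≡2n+1 _ = [ (λ cp≤ → cross-≤-trans (A + B) c d 1≤p viaP (subst (λ t → c * p ≤ d * t) (sym A+B≡2n+1) cp≤))
                          , (λ cm≤ → cross-≤-trans (A + B) c d 1≤AB viaAB (subst (λ t → c * (A * B) ≤ d * t) (sym A+B≡2n+1) cm≤))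
                          ] (balanced (A * B) (AB≤n[n+1] {A} {B} {n} A+B≡2n+1))
  where
  1≤AB : 1 ≤ A * B
  1≤AB = ℕP.*-mono-≤ 1≤A 1≤B
... | tri< A+B<2n+1 _ _ = cross-≤-trans (A + B) c d (ℕP.*-mono-≤ 1≤A 1≤B) viaAB (ℕP.*-cancelˡ-≤ 2 (begin
  2 * (c * (A * B)) ≡⟨ solve (c ∷ A ∷ B ∷ []) ⟩
  c * (2 * (A * B)) ≤⟨ ℕP.*-monoʳ-≤ c (2AB≤n[A+B] {A} {B} {n} A+B≤2n) ⟩
  c * (n * (A + B)) ≡⟨ ℕP.*-assoc c n (A + B) ⟨
  c * n * (A + B)   ≤⟨ ℕP.*-monoˡ-≤ (A + B) small ⟩
  2 * d * (A + B)   ≡⟨ ℕP.*-assoc 2 d (A + B) ⟩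
  2 * (d * (A + B)) ∎))
  where
  open ℕP.≤-Reasoning
  A+B≤2n : A + B ≤ 2 * n
  A+B≤2n = ℕP.m<1+n⇒m≤n (subst (A + B <_) (ℕP.+-comm (2 * n) 1) A+B<2n+1)

pigeonhole : ∀ {u v p x y} → u + v ≤ suc p → x + y ≡ p → u ≤ x ⊎ v ≤ y
pigeonhole {u} {v} {p} {x} {y} u+v≤1+p x+y≡p with u ≤? x
... | yes u≤x = inj₁ u≤x
... | no u≰x = inj₂ (ℕP.+-cancelˡ-≤ (suc x) v y (begin
  suc x + v ≤⟨ ℕP.+-monoˡ-≤ v (ℕP.≰⇒> u≰x) ⟩
  u + v     ≤⟨ u+v≤1+p ⟩
  suc p     ≡⟨ cong suc x+y≡p ⟨
  suc x + y ∎))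
  where open ℕP.≤-Reasoning

pigeonhole-* : ∀ u v {p} x y → x + y ≡ p → (u * x < p → v * x + p ≤ v * p) → p ≤ u * x ⊎ p ≤ v * y
pigeonhole-* u v {p} x y x+y≡p room with p ≤? u * x
... | yes p≤ux = inj₁ p≤ux
... | no p≰ux = inj₂ (ℕP.+-cancelˡ-≤ (v * x) p (v * y) (begin
  v * x + p   ≤⟨ room (ℕP.≰⇒> p≰ux) ⟩
  v * p       ≡⟨ cong (v *_) x+y≡p ⟨
  v * (x + y) ≡⟨ ℕP.*-distribˡ-+ v x y ⟩
  v * x + v * y ∎))
  where open ℕP.≤-Reasoning

n+n≤1+n² : ∀ n → n + n ≤ suc (n * n)
n+n≤1+n² zero    = z≤n
n+n≤1+n² (suc k) = ℕP.≤-trans (ℕP.m≤m+n _ (k * k)) (ℕP.≤-reflexive (solve (k ∷ [])))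

n≡n%2+[n/2]*2 : ∀ n → n ≡ n % 2 + n / 2 * 2
n≡n%2+[n/2]*2 n = ℕD.m≡m%n+[m/n]*n n 2

2*[n/2]≤n : ∀ n → 2 * (n / 2) ≤ n
2*[n/2]≤n n = subst (2 * (n / 2) ≤_) (sym (n≡n%2+[n/2]*2 n))
  (ℕP.≤-trans (ℕP.≤-reflexive (ℕP.*-comm 2 (n / 2))) (ℕP.m≤n+m (n / 2 * 2) (n % 2)))

n≤1+2*[n/2] : ∀ n → n ≤ suc (2 * (n / 2))
n≤1+2*[n/2] n = subst (_≤ suc (2 * (n / 2))) (sym (n≡n%2+[n/2]*2 n))
  (ℕP.+-mono-≤ (ℕP.m<1+n⇒m≤n (ℕD.m%n<n n 2)) (ℕP.≤-reflexive (ℕP.*-comm (n / 2) 2)))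

module WeightOfP₂ (p n h : ℕ) .{{_ : ℕ.NonZero p}} .{{_ : ℕ.NonZero n}}
                  (2h≤n : 2 * h ≤ n) (n≤1+2h : n ≤ suc (2 * h))
                  (n²≤p : n * n ≤ p) (p<[n+1]² : p < suc n * suc n) where
  open ℕP.≤-Reasoning

  1≤p : 1 ≤ p
  1≤p = ℕ.>-nonZero⁻¹ p

  1≤n : 1 ≤ n
  1≤n = ℕ.>-nonZero⁻¹ n

  n≤n² : n ≤ n * n
  n≤n² = subst (_≤ n * n) (ℕP.*-identityʳ n) (ℕP.*-monoʳ-≤ n 1≤n)

  ≤1* : ∀ {x y} → x ≤ y → x ≤ 1 * y
  ≤1* {x} {y} = subst (x ≤_) (sym (ℕP.*-identityˡ y))

  case₁ : p ≤ n * n + h → PebblingWeightIs P₂ p (2 ÷ n)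
  case₁ p≤n²+h =
    weight-≤ {p} {2} {n} 1 n 1 n 1≤n 1≤n total
      (n , ≤1* n²≤p , ≤1* ℕP.≤-refl) (n , ≤1* n²≤p , ≤1* ℕP.≤-refl) split ,
    weight-≥ {p} {2} {n} (weightLowerBound {p} {n} {2} {n} 1≤p
      (ℕP.≤-trans 2p≤n[2n+1] (ℕP.*-monoʳ-≤ n (ℕP.+-monoʳ-≤ (2 * n) (s≤s z≤n)))) ℕP.≤-refl
      (λ _ _ → inj₁ 2p≤n[2n+1]))
    where
    total : (1 * n + 1 * n) * n ≡ 2 * (n * n)
    total = solve (n ∷ [])
    split : ∀ x y → x + y ≡ p → n ≤ 1 * x ⊎ n ≤ 1 * y
    split x y x+y≡p = Sum.map ≤1* ≤1* (pigeonhole (ℕP.≤-trans (n+n≤1+n² n) (s≤s n²≤p)) x+y≡p)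
    2p≤n[2n+1] : 2 * p ≤ n * (2 * n + 1)
    2p≤n[2n+1] = begin
      2 * p               ≤⟨ ℕP.*-monoʳ-≤ 2 p≤n²+h ⟩
      2 * (n * n + h)     ≡⟨ ℕP.*-distribˡ-+ 2 (n * n) h ⟩
      2 * (n * n) + 2 * h ≤⟨ ℕP.+-monoʳ-≤ (2 * (n * n)) 2h≤n ⟩
      2 * (n * n) + n     ≡⟨ solve (n ∷ []) ⟩
      n * (2 * n + 1)     ∎

  case₂ : n * n + h < p → p ≤ n * n + 2 * h → PebblingWeightIs P₂ p ((2 * n + 1) ÷ p)
  case₂ n²+h<p p≤n²+2h =
    weight-≤ {p} {2 * n + 1} {p} n p (n + 1) p (ℕP.≤-trans (ℕP.m≤m+n n 1) n+1≤p) n+1≤p total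
      (n , ℕP.≤-refl , subst (p ≤_) (ℕP.*-comm n (n + 1)) p≤n[n+1]) (n + 1 , ℕP.≤-refl , p≤n[n+1]) split ,
    weight-≥ {p} {2 * n + 1} {p} (weightLowerBound {p} {n} {2 * n + 1} {p} 1≤p
      (ℕP.≤-trans (ℕP.≤-reflexive (ℕP.*-comm (2 * n + 1) p)) (ℕP.*-monoʳ-≤ p (ℕP.+-monoʳ-≤ (2 * n) (s≤s z≤n))))
      [2n+1]n≤2p (λ _ _ → inj₁ (ℕP.≤-reflexive (ℕP.*-comm (2 * n + 1) p))))
    where
    1≤h : 1 ≤ h
    1≤h = ℕP.+-cancelʳ-≤ h 1 h (begin
      suc h     ≤⟨ ℕP.+-cancelˡ-≤ (n * n) (suc h) (2 * h)
                     (subst (_≤ n * n + 2 * h) (sym (ℕP.+-suc (n * n) h)) (ℕP.≤-trans n²+h<p p≤n²+2h)) ⟩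
      2 * h     ≡⟨ solve (h ∷ []) ⟩
      h + h     ∎)
    3≤n+1 : 3 ≤ n + 1
    3≤n+1 = subst (3 ≤_) (ℕP.+-comm 1 n) (s≤s (ℕP.≤-trans (ℕP.*-monoʳ-≤ 2 1≤h) 2h≤n))
    n+1≤p : n + 1 ≤ p
    n+1≤p = ℕP.≤-trans (ℕP.+-monoˡ-≤ 1 (ℕP.≤-trans n≤n² (ℕP.m≤m+n (n * n) h)))
                       (ℕP.≤-trans (ℕP.≤-reflexive (ℕP.+-comm (n * n + h) 1)) n²+h<p)
    p≤n[n+1] : p ≤ n * (n + 1)
    p≤n[n+1] = begin
      p             ≤⟨ p≤n²+2h ⟩
      n * n + 2 * h ≤⟨ ℕP.+-monoʳ-≤ (n * n) 2h≤n ⟩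
      n * n + n     ≡⟨ solve (n ∷ []) ⟩
      n * (n + 1)   ∎
    total : (n * p + (n + 1) * p) * p ≡ (2 * n + 1) * (p * p)
    total = solve (n ∷ p ∷ [])
    split : ∀ x y → x + y ≡ p → p ≤ n * x ⊎ p ≤ (n + 1) * y
    split x y x+y≡p = pigeonhole-* n (n + 1) x y x+y≡p λ nx<p → begin
      (n + 1) * x + p ≡⟨ solve (n ∷ x ∷ p ∷ []) ⟩
      n * x + x + p   ≤⟨ ℕP.+-monoˡ-≤ p (ℕP.+-mono-≤ (ℕP.<⇒≤ nx<p) (subst (x ≤_) x+y≡p (ℕP.m≤m+n x y))) ⟩
      p + p + p       ≡⟨ solve (p ∷ []) ⟩
      3 * p           ≤⟨ ℕP.*-monoˡ-≤ p 3≤n+1 ⟩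
      (n + 1) * p     ∎
    [2n+1]n≤2p : (2 * n + 1) * n ≤ 2 * p
    [2n+1]n≤2p = begin
      (2 * n + 1) * n                 ≡⟨ solve (n ∷ []) ⟩
      2 * (n * n) + n                 ≤⟨ ℕP.+-monoʳ-≤ (2 * (n * n)) n≤1+2h ⟩
      2 * (n * n) + suc (2 * h)       ≤⟨ ℕP.n≤1+n _ ⟩
      suc (2 * (n * n) + suc (2 * h)) ≡⟨ solve (n ∷ h ∷ []) ⟩
      2 * suc (n * n + h)             ≤⟨ ℕP.*-monoʳ-≤ 2 n²+h<p ⟩
      2 * p                           ∎

  case₃ : n * n + 2 * h < p → p ≤ n * n + n + h → PebblingWeightIs P₂ p ((2 * n + 1) ÷ (n * (n + 1)))
  case₃ n²+2h<p p≤n²+n+h =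
    weight-≤ {p} {2 * n + 1} {n * (n + 1)} {{n[n+1]≢0}} 1 n 1 (1 + n) 1≤n (s≤s z≤n) total
      (1 + n , ≤1* (subst (_≤ p) (ℕP.*-comm n (1 + n)) n[1+n]≤p) , ≤1* ℕP.≤-refl)
      (n , ≤1* n[1+n]≤p , ≤1* ℕP.≤-refl) split ,
    weight-≥ {p} {2 * n + 1} {n * (n + 1)} {{n[n+1]≢0}} (weightLowerBound {p} {n} {2 * n + 1} {n * (n + 1)} 1≤p
      [2n+1]p≤n[n+1][2n+2] [2n+1]n≤2n[n+1]
      (λ m m≤n[n+1] → inj₂ (ℕP.≤-trans (ℕP.*-monoʳ-≤ (2 * n + 1) m≤n[n+1]) (ℕP.≤-reflexive (ℕP.*-comm (2 * n + 1) _)))))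
    where
    n[n+1]≢0 : ℕ.NonZero (n * (n + 1))
    n[n+1]≢0 = ℕ.>-nonZero (ℕP.*-mono-≤ 1≤n (ℕP.m≤n+m 1 n))
    n[1+n]≤p : n * (1 + n) ≤ p
    n[1+n]≤p = begin
      n * (1 + n)         ≡⟨ solve (n ∷ []) ⟩
      n * n + n           ≤⟨ ℕP.+-monoʳ-≤ (n * n) n≤1+2h ⟩
      n * n + suc (2 * h) ≡⟨ ℕP.+-suc (n * n) (2 * h) ⟩
      suc (n * n + 2 * h) ≤⟨ n²+2h<p ⟩
      p                   ∎
    total : (1 * (1 + n) + 1 * n) * (n * (n + 1)) ≡ (2 * n + 1) * (n * (1 + n))
    total = solve (n ∷ [])
    split : ∀ x y → x + y ≡ p → n ≤ 1 * x ⊎ 1 + n ≤ 1 * y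
    split x y x+y≡p = Sum.map ≤1* ≤1* (pigeonhole n+[1+n]≤1+p x+y≡p)
      where
      n+[1+n]≤1+p : n + (1 + n) ≤ 1 + p
      n+[1+n]≤1+p = begin
        n + (1 + n)     ≡⟨ solve (n ∷ []) ⟩
        1 + (n + n)     ≤⟨ s≤s (ℕP.+-monoˡ-≤ n n≤n²) ⟩
        1 + (n * n + n) ≡⟨ cong suc (solve (n ∷ [])) ⟩
        1 + n * (1 + n) ≤⟨ s≤s n[1+n]≤p ⟩
        1 + p           ∎
    [2n+1]p≤n[n+1][2n+2] : (2 * n + 1) * p ≤ n * (n + 1) * (2 * n + 2)
    [2n+1]p≤n[n+1][2n+2] = ℕP.*-cancelˡ-≤ 2 (begin
      2 * ((2 * n + 1) * p)                                   ≤⟨ ℕP.*-monoʳ-≤ 2 (ℕP.*-monoʳ-≤ (2 * n + 1) p≤n²+n+h) ⟩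
      2 * ((2 * n + 1) * (n * n + n + h))                     ≡⟨ solve (n ∷ h ∷ []) ⟩
      (2 * n + 1) * (2 * (n * n + n)) + (2 * n + 1) * (2 * h) ≤⟨ ℕP.+-monoʳ-≤ ((2 * n + 1) * (2 * (n * n + n))) (ℕP.*-monoʳ-≤ (2 * n + 1) 2h≤n) ⟩
      (2 * n + 1) * (2 * (n * n + n)) + (2 * n + 1) * n       ≤⟨ ℕP.m≤m+n _ n ⟩
      (2 * n + 1) * (2 * (n * n + n)) + (2 * n + 1) * n + n   ≡⟨ solve (n ∷ []) ⟩
      2 * (n * (n + 1) * (2 * n + 2))                         ∎)
    [2n+1]n≤2n[n+1] : (2 * n + 1) * n ≤ 2 * (n * (n + 1))
    [2n+1]n≤2n[n+1] = begin
      (2 * n + 1) * n     ≤⟨ ℕP.m≤m+n _ n ⟩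
      (2 * n + 1) * n + n ≡⟨ solve (n ∷ []) ⟩
      2 * (n * (n + 1))   ∎

  case₄ : n * n + n + h < p → PebblingWeightIs P₂ p ((2 * n + 2) ÷ p)
  case₄ n²+n+h<p =
    weight-≤ {p} {2 * n + 2} {p} (1 + n) p (1 + n) p 1+n≤p 1+n≤p total
      (1 + n , ℕP.≤-refl , ℕP.<⇒≤ p<[n+1]²) (1 + n , ℕP.≤-refl , ℕP.<⇒≤ p<[n+1]²) split ,
    weight-≥ {p} {2 * n + 2} {p} (weightLowerBound {p} {n} {2 * n + 2} {p} 1≤p
      (ℕP.≤-reflexive (ℕP.*-comm (2 * n + 2) p)) [2n+2]n≤2p
      (λ m m≤n[n+1] → inj₂ (ℕP.≤-trans (ℕP.*-monoʳ-≤ (2 * n + 2) m≤n[n+1]) [2n+2]n[n+1]≤p[2n+1])))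
    where
    n²+n<p : n * n + n < p
    n²+n<p = ℕP.≤-trans (s≤s (ℕP.m≤m+n (n * n + n) h)) n²+n+h<p
    1+n≤p : 1 + n ≤ p
    1+n≤p = ℕP.≤-trans (s≤s (ℕP.m≤n+m n (n * n))) n²+n<p
    total : ((1 + n) * p + (1 + n) * p) * p ≡ (2 * n + 2) * (p * p)
    total = solve (n ∷ p ∷ [])
    split : ∀ x y → x + y ≡ p → p ≤ (1 + n) * x ⊎ p ≤ (1 + n) * y
    split x y x+y≡p = pigeonhole-* (1 + n) (1 + n) x y x+y≡p λ [1+n]x<p → begin
      (1 + n) * x + p ≤⟨ ℕP.+-monoˡ-≤ p (ℕP.<⇒≤ [1+n]x<p) ⟩
      p + p           ≡⟨ solve (p ∷ []) ⟩
      2 * p           ≤⟨ ℕP.*-monoˡ-≤ p (s≤s 1≤n) ⟩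
      (1 + n) * p     ∎
    [2n+2]n≤2p : (2 * n + 2) * n ≤ 2 * p
    [2n+2]n≤2p = begin
      (2 * n + 2) * n ≡⟨ solve (n ∷ []) ⟩
      2 * (n * n + n) ≤⟨ ℕP.*-monoʳ-≤ 2 (ℕP.<⇒≤ n²+n<p) ⟩
      2 * p           ∎
    [2n+2]n[n+1]≤p[2n+1] : (2 * n + 2) * (n * (n + 1)) ≤ p * (2 * n + 1)
    [2n+2]n[n+1]≤p[2n+1] = ℕP.*-cancelˡ-≤ 2 (begin
      2 * ((2 * n + 2) * (n * (n + 1)))                                  ≤⟨ ℕP.m≤m+n _ (n + 1) ⟩
      2 * ((2 * n + 2) * (n * (n + 1))) + (n + 1)                        ≡⟨ solve (n ∷ []) ⟩
      (2 * n + 1) * (2 * (n * n + n)) + (2 * n + 1) * (n + 1)            ≤⟨ ℕP.+-monoʳ-≤ ((2 * n + 1) * (2 * (n * n + n))) (ℕP.*-monoʳ-≤ (2 * n + 1) (ℕP.+-monoˡ-≤ 1 n≤1+2h)) ⟩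
      (2 * n + 1) * (2 * (n * n + n)) + (2 * n + 1) * (suc (2 * h) + 1)  ≡⟨ solve (n ∷ h ∷ []) ⟩
      (2 * n + 1) * (2 * suc (n * n + n + h))                            ≤⟨ ℕP.*-monoʳ-≤ (2 * n + 1) (ℕP.*-monoʳ-≤ 2 n²+n+h<p) ⟩
      (2 * n + 1) * (2 * p)                                              ≡⟨ solve (n ∷ p ∷ []) ⟩
      2 * (p * (2 * n + 1))                                              ∎)

if-≤ᵇ : ∀ {a} {A : Set a} m k (P : A → Set) {x y : A} →
  (m ≤ k → P x) → (k < m → P y) → P (if m ≤ᵇ k then x else y)
if-≤ᵇ m k P Px Py with m ≤ᵇ k | ℕP.≤ᵇ-reflects-≤ m k
... | true  | ofʸ m≤k = Px m≤k
... | false | ofⁿ m≰k = Py (ℕP.≰⇒> m≰k)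

theorem10 : (p n : ℕ) → 1 ≤ p → n * n ≤ p → p < suc n * suc n →
    PebblingWeightIs P₂ p (P₂value p n)
theorem10 zero      _         ()
theorem10 (suc _)   zero      _ _ (s≤s ())
theorem10 p@(suc _) n@(suc _) _ n²≤p p<[n+1]² =
  if-≤ᵇ p (n * n + h) (PebblingWeightIs P₂ p) case₁ λ n²+h<p →
  if-≤ᵇ p (n * n + 2 * h) (PebblingWeightIs P₂ p) (case₂ n²+h<p) λ n²+2h<p →
  if-≤ᵇ p (n * n + n + h) (PebblingWeightIs P₂ p) (case₃ n²+2h<p) case₄
  where
  h : ℕ
  h = n / 2
  open WeightOfP₂ p n h (2*[n/2]≤n n) (n≤1+2*[n/2] n) n²≤p p<[n+1]²
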